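{- For all non-negative integers $n$, \[T_{n}^2=\delta_{n,2}+T_{n-1}^2+3T_{n-2}^2+9T_{n-3}^2+4\sum_{l=4}^{n-2}(T_l+T_{l-1})T_{n-l}^2.\]
   Context: Tribonacci numbers: $T_n=T_{n-1}+T_{n-2}+T_{n-3}+\delta_{n,2}$ for all integers $n$, with $T_n=0$ for $n<2$; $\delta_{i,j}$ is $1$ if $i=j$ and $0$ otherwise. Empty sums are zero. -}

module Defs where

open import Data.Nat using (ℕ; zero; suc; _+_; _*_; _∸_; _≤ᵇ_)
open import Data.Bool using (if_then_else_)

T : ℕ → ℕ
T 0 = 0
T 1 = 0
T 2 = 1
T (suc (suc (suc n))) = T (suc (suc n)) + T (suc n) + T n

-- T at the integer index n - k (which is 0 when n - k < 0)
Tm : ℕ → ℕ → ℕ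
Tm n k = if k ≤ᵇ n then T (n ∸ k) else 0

δ : ℕ → ℕ → ℕ
δ zero zero = 1
δ zero (suc _) = 0
δ (suc _) zero = 0
δ (suc m) (suc n) = δ m n

sumFromTo : ℕ → ℕ → (ℕ → ℕ) → ℕ
sumFromTo a b f = go (suc b ∸ a)
  where
  go : ℕ → ℕ
  go zero = 0
  go (suc k) = go k + f (a + k)

{-# OPTIONS --safe #-}
-- Write b k = T k ^ 2.  Squares of any sequence obeying the tribonacci
-- recurrence satisfy b (k+6) + b (k+2) + b k = 2 b (k+5) + 3 b (k+4) + 6 b (k+3).
-- The convolution C m o = Σ_{j<m} (T (o+j) + T (o+j-1)) b (m+1-j) is, for o ≥ 1,
-- a tribonacci sequence in o, and dropping its first term gives
-- C (m+1) o = (T o + T (o-1)) b (m+2) + C m (o+1).  Expressing C (m+1) 4,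
-- C (m+2) 4, C (m+3) 4 through C m 4, C m 5, C m 6 in this way, the identity for
-- n = m + 8 becomes a linear consequence of those for n = m + 5, m + 6, m + 7 and
-- of the square recurrence; the cases n ≤ 7 are checked by computation.
module Submission where

open import Defs
open import Data.Nat using (ℕ; zero; suc; _+_; _*_; _∸_; _^_)
open import Data.Nat.Properties using (+-identityʳ; +-suc; +-assoc; +-cancelʳ-≡; *-distribʳ-+)
open import Data.Nat.Tactic.RingSolver using (solve-∀)
open import Relation.Binary.PropositionalEquality
  using (_≡_; refl; sym; trans; cong; cong₂; subst; module ≡-Reasoning)

sumBelow : ℕ → (ℕ → ℕ) → ℕ
sumBelow zero    f = 0
sumBelow (suc m) f = sumBelow m f + f m

sumBelow-cong : ∀ m {f g : ℕ → ℕ} → (∀ j → f j ≡ g j) → sumBelow m f ≡ sumBelow m g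
sumBelow-cong zero    f≗g = refl
sumBelow-cong (suc m) f≗g = cong₂ _+_ (sumBelow-cong m f≗g) (f≗g m)

sumBelow-suc : ∀ m (f : ℕ → ℕ) → sumBelow (suc m) f ≡ f 0 + sumBelow m (λ j → f (suc j))
sumBelow-suc zero    f = sym (+-identityʳ (f 0))
sumBelow-suc (suc m) f =
  trans (cong (_+ f (suc m)) (sumBelow-suc m f)) (+-assoc (f 0) (sumBelow m (λ j → f (suc j))) (f (suc m)))

sumFromTo-4 : ∀ m f → sumFromTo 4 (3 + m) f ≡ sumBelow m (λ j → f (4 + j))
sumFromTo-4 zero    f = refl
sumFromTo-4 (suc m) f = cong (_+ f (4 + m)) (sumFromTo-4 m f)

IsTribonacci : (ℕ → ℕ) → Set
IsTribonacci u = ∀ n → u (3 + n) ≡ u (2 + n) + u (1 + n) + u n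

T-isTribonacci : IsTribonacci T
T-isTribonacci n = refl

isTribonacci-+ : ∀ {u v} → IsTribonacci u → IsTribonacci v → IsTribonacci (λ n → u n + v n)
isTribonacci-+ {u} {v} u-rec v-rec n =
  trans (cong₂ _+_ (u-rec n) (v-rec n)) (interchange (u (2 + n)) (u (1 + n)) (u n) (v (2 + n)) (v (1 + n)) (v n))
  where
  interchange : ∀ a b c d e f → (a + b + c) + (d + e + f) ≡ (a + d) + (b + e) + (c + f)
  interchange = solve-∀

isTribonacci-*ʳ : ∀ {u} c → IsTribonacci u → IsTribonacci (λ n → u n * c)
isTribonacci-*ʳ {u} c u-rec n = begin
  u (3 + n) * c                             ≡⟨ cong (_* c) (u-rec n) ⟩
  (u (2 + n) + u (1 + n) + u n) * c         ≡⟨ *-distribʳ-+ c (u (2 + n) + u (1 + n)) (u n) ⟩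
  (u (2 + n) + u (1 + n)) * c + u n * c     ≡⟨ cong (_+ u n * c) (*-distribʳ-+ c (u (2 + n)) (u (1 + n))) ⟩
  u (2 + n) * c + u (1 + n) * c + u n * c   ∎
  where open ≡-Reasoning

isTribonacci-sumBelow : ∀ m {g : ℕ → ℕ → ℕ} →
  (∀ j → IsTribonacci (λ o → g o j)) → IsTribonacci (λ o → sumBelow m (g o))
isTribonacci-sumBelow zero    g-rec n = refl
isTribonacci-sumBelow (suc m) {g} g-rec =
  isTribonacci-+ {λ o → sumBelow m (g o)} {λ o → g o m} (isTribonacci-sumBelow m g-rec) (g-rec m)

square-recurrence : ∀ {u} → IsTribonacci u → ∀ n →
  u (6 + n) ^ 2 + u (2 + n) ^ 2 + u n ^ 2 ≡ 2 * u (5 + n) ^ 2 + 3 * u (4 + n) ^ 2 + 6 * u (3 + n) ^ 2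
square-recurrence {u} u-rec n
  rewrite u-rec (3 + n) | u-rec (2 + n) | u-rec (1 + n) | u-rec n = identity (u n) (u (1 + n)) (u (2 + n))
  where
  -- The solver does not support _^_, but x ^ 2 unfolds to x * (x * 1).
  identity : ∀ x y z →
    let t₃ = z + y + x ; t₄ = t₃ + z + y ; t₅ = t₄ + t₃ + z ; t₆ = t₅ + t₄ + t₃
        sq = λ t → t * (t * 1) in
    sq t₆ + sq z + sq x ≡ 2 * sq t₅ + 3 * sq t₄ + 6 * sq t₃
  identity = solve-∀

Tpair : ℕ → ℕ
Tpair l = T l + T (l ∸ 1)

Tpair-isTribonacci : IsTribonacci (λ n → Tpair (suc n))
Tpair-isTribonacci = isTribonacci-+ {λ n → T (suc n)} {T} (λ n → refl) T-isTribonacci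

-- With o = 4 this is the sum in the theorem for n = m + 5, reindexed by l = 4 + j.
conv : ℕ → ℕ → ℕ
conv m o = sumBelow m (λ j → Tpair (o + j) * T (suc m ∸ j) ^ 2)

conv-suc : ∀ m o → conv (suc m) o ≡ Tpair o * T (2 + m) ^ 2 + conv m (suc o)
conv-suc m o =
  trans (sumBelow-suc m (λ j → Tpair (o + j) * T (2 + m ∸ j) ^ 2))
        (cong₂ _+_ (cong (λ k → Tpair k * T (2 + m) ^ 2) (+-identityʳ o))
                   (sumBelow-cong m (λ j → cong (λ k → Tpair k * T (suc m ∸ j) ^ 2) (+-suc o j))))

conv-isTribonacci : ∀ m → IsTribonacci (λ o → conv m (suc o))
conv-isTribonacci m =
  isTribonacci-sumBelow m λ j →
    isTribonacci-*ʳ {λ o → Tpair (suc o + j)} (T (suc m ∸ j) ^ 2) (λ n → Tpair-isTribonacci (n + j))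

ConvolutionIdentity : ℕ → ℕ → Set
ConvolutionIdentity m c = T (5 + m) ^ 2 ≡ T (4 + m) ^ 2 + 3 * T (3 + m) ^ 2 + 9 * T (2 + m) ^ 2 + 4 * c

linear-step : ∀ (x : ℕ → ℕ) {c₄ c₅ c₆} →
  x 5 ≡ x 4 + 3 * x 3 + 9 * x 2 + 4 * c₄ →
  x 6 ≡ x 5 + 3 * x 4 + 9 * x 3 + 4 * (3 * x 2 + c₅) →
  x 7 ≡ x 6 + 3 * x 5 + 9 * x 4 + 4 * (3 * x 3 + (6 * x 2 + c₆)) →
  x 8 + x 4 + x 2 ≡ 2 * x 7 + 3 * x 6 + 6 * x 5 →
  x 8 ≡ x 7 + 3 * x 6 + 9 * x 5 + 4 * (3 * x 4 + (6 * x 3 + (11 * x 2 + (c₆ + c₅ + c₄))))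
linear-step x {c₄} {c₅} {c₆} x₅≡ x₆≡ x₇≡ square-rec =
  +-cancelʳ-≡ (x 4 + x 2) (x 8) _ (begin
    x 8 + (x 4 + x 2)              ≡⟨ sym (+-assoc (x 8) (x 4) (x 2)) ⟩
    x 8 + x 4 + x 2                ≡⟨ square-rec ⟩
    2 * x 7 + 3 * x 6 + 6 * x 5    ≡⟨ eliminate x₇≡ x₆≡ x₅≡ ⟩
    _                              ∎)
  where
  open ≡-Reasoning
  identity : ∀ x₂ x₃ x₄ c₄ c₅ c₆ →
    let x₅ = x₄ + 3 * x₃ + 9 * x₂ + 4 * c₄
        x₆ = x₅ + 3 * x₄ + 9 * x₃ + 4 * (3 * x₂ + c₅)
        x₇ = x₆ + 3 * x₅ + 9 * x₄ + 4 * (3 * x₃ + (6 * x₂ + c₆)) in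
    2 * x₇ + 3 * x₆ + 6 * x₅
      ≡ x₇ + 3 * x₆ + 9 * x₅ + 4 * (3 * x₄ + (6 * x₃ + (11 * x₂ + (c₆ + c₅ + c₄)))) + (x₄ + x₂)
  identity = solve-∀
  eliminate : ∀ {x₅ x₆ x₇} →
    x₇ ≡ x₆ + 3 * x₅ + 9 * x 4 + 4 * (3 * x 3 + (6 * x 2 + c₆)) →
    x₆ ≡ x₅ + 3 * x 4 + 9 * x 3 + 4 * (3 * x 2 + c₅) →
    x₅ ≡ x 4 + 3 * x 3 + 9 * x 2 + 4 * c₄ →
    2 * x₇ + 3 * x₆ + 6 * x₅
      ≡ x₇ + 3 * x₆ + 9 * x₅ + 4 * (3 * x 4 + (6 * x 3 + (11 * x 2 + (c₆ + c₅ + c₄)))) + (x 4 + x 2)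
  eliminate refl refl refl = identity (x 2) (x 3) (x 4) c₄ c₅ c₆

convolution-identity : ∀ m → ConvolutionIdentity m (conv m 4)
convolution-identity 0 = refl
convolution-identity 1 = refl
convolution-identity 2 = refl
convolution-identity (suc (suc (suc m))) =
  subst (ConvolutionIdentity (3 + m)) (sym conv-3+m)
    (linear-step (λ k → T (k + m) ^ 2)
      (convolution-identity m)
      (subst (ConvolutionIdentity (1 + m)) (conv-suc m 4) (convolution-identity (suc m)))
      (subst (ConvolutionIdentity (2 + m)) conv-2+m (convolution-identity (suc (suc m))))
      (square-recurrence {T} T-isTribonacci (2 + m)))
  where
  conv-2+m : conv (2 + m) 4 ≡ 3 * T (3 + m) ^ 2 + (6 * T (2 + m) ^ 2 + conv m 6)
  conv-2+m = trans (conv-suc (1 + m) 4) (cong (3 * T (3 + m) ^ 2 +_) (conv-suc m 5))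
  conv-3+m : conv (3 + m) 4
           ≡ 3 * T (4 + m) ^ 2 + (6 * T (3 + m) ^ 2 + (11 * T (2 + m) ^ 2 + (conv m 6 + conv m 5 + conv m 4)))
  conv-3+m = trans (conv-suc (2 + m) 4) (cong (3 * T (4 + m) ^ 2 +_)
               (trans (conv-suc (1 + m) 5) (cong (6 * T (3 + m) ^ 2 +_)
                 (trans (conv-suc m 6) (cong (11 * T (2 + m) ^ 2 +_) (conv-isTribonacci m 3))))))

mainTheorem5 : (n : ℕ) →
    T n ^ 2 ≡ δ n 2 + Tm n 1 ^ 2 + 3 * Tm n 2 ^ 2 + 9 * Tm n 3 ^ 2
      + 4 * sumFromTo 4 (n ∸ 2) (λ l → (T l + T (l ∸ 1)) * T (n ∸ l) ^ 2)
mainTheorem5 0 = refl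
mainTheorem5 1 = refl
mainTheorem5 2 = refl
mainTheorem5 3 = refl
mainTheorem5 4 = refl
mainTheorem5 (suc (suc (suc (suc (suc m))))) =
  subst (ConvolutionIdentity m) (sym (sumFromTo-4 m _)) (convolution-identity m)
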